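{- Let $q\geqslant 2$ be an even integer and $n\geqslant1$. (1) Let $f:\mathbb{F}_2^n\to\mathbb{Z}_q$ be a regular generalized bent function with dual $\widetilde f$. Define $h:\mathbb{F}_2^{n+2}\to\mathbb{Z}_q$ by $h(0,0,x)=f(x)$, $h(0,1,x)=\widetilde f(x)$, $h(1,0,x)=\widetilde f(x)$, $h(1,1,x)=f(x)+q/2$ for $x\in\mathbb{F}_2^n$ (i.e. its sign function is $(F,\widetilde F,\widetilde F,-F)$ with $F=\omega^f$, $\widetilde F=\omega^{\widetilde f}$). Then $h$ is a self-dual generalized bent function in $n+2$ variables. (2) Let $f:\mathbb{F}_2^n\to\mathbb{Z}_q$ be a self-dual and $g:\mathbb{F}_2^n\to\mathbb{Z}_q$ an anti-self-dual generalized bent function. Define $h:\mathbb{F}_2^{n+2}\to\mathbb{Z}_q$ by $h(0,0,x)=f(x)$, $h(0,1,x)=g(x)$, $h(1,0,x)=g(x)+q/2$, $h(1,1,x)=f(x)$ (i.e. its sign function is $(F,G,-G,F)$ with $F=\omega^f$, $G=\omega^g$). Then $h$ is a generalized bent function in $n+2$ variables.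
   Context: $\omega=e^{2\pi i/q}$. For $f:\mathbb{F}_2^n\to\mathbb{Z}_q$, $H_f(y)=\sum_{x\in\mathbb{F}_2^n}\omega^{f(x)}(-1)^{\langle x,y\rangle}$ with $\langle x,y\rangle=\bigoplus_ix_iy_i$. $f$ is generalized bent if $|H_f(y)|=2^{n/2}$ for all $y$; regular if $H_f(y)=2^{n/2}\omega^{\widetilde f(y)}$ for some $\widetilde f:\mathbb{F}_2^n\to\mathbb{Z}_q$ (the dual) and all $y$; self-dual if moreover $\widetilde f=f$, anti-self-dual if $\widetilde f=f+q/2$. -}

module Defs where

open import Level using (Level; _⊔_) renaming (suc to lsuc)
open import Data.Nat using (ℕ; zero; suc; _<_; NonZero) renaming (_+_ to _+ℕ_)
open import Data.Nat.DivMod using (_mod_; _/_)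
open import Data.Fin using (Fin; toℕ)
open import Data.Bool using (Bool; true; false; _xor_; _∧_)
open import Data.Vec using (Vec; []; _∷_)
open import Data.Sum using (_⊎_)
open import Relation.Nullary using (¬_)
open import Algebra.Bundles using (CommutativeRing)

-- Vectors of F₂ⁿ are  Vec Bool n  (false = 0, true = 1).

dot : ∀ {n} → Vec Bool n → Vec Bool n → Bool
dot []       []       = false
dot (a ∷ x)  (b ∷ y)  = (a ∧ b) xor dot x y

shiftHalf : (q : ℕ) .{{_ : NonZero q}} → Fin q → Fin q
shiftHalf q a = (toℕ a +ℕ q / 2) mod q

glue4 : ∀ {n} {Z : Set} → (Vec Bool n → Z) → (Vec Bool n → Z) →
        (Vec Bool n → Z) → (Vec Bool n → Z) → Vec Bool (suc (suc n)) → Z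
glue4 A B C D (false ∷ false ∷ x) = A x
glue4 A B C D (false ∷ true  ∷ x) = B x
glue4 A B C D (true  ∷ false ∷ x) = C x
glue4 A B C D (true  ∷ true  ∷ x) = D x

module RingOps {c ℓ : Level} (R : CommutativeRing c ℓ) where
  open CommutativeRing R

  pow : Carrier → ℕ → Carrier
  pow a zero    = 1#
  pow a (suc k) = a * pow a k

  fromℕ : ℕ → Carrier
  fromℕ zero    = 0#
  fromℕ (suc k) = 1# + fromℕ k

  sumF2 : (n : ℕ) → (Vec Bool n → Carrier) → Carrier
  sumF2 zero    F = F []
  sumF2 (suc n) F = sumF2 n (λ x → F (false ∷ x)) + sumF2 n (λ x → F (true ∷ x))

  sgn : Bool → Carrier
  sgn false = 1#
  sgn true  = - 1#

-- The complex setting, axiomatised: a characteristic-0 integral domain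
-- with a primitive q-th root of unity ω, a square root s of 2 (playing
-- 2^{1/2}, so 2^{n/2} = sⁿ) and an involutive ring automorphism conj
-- (complex conjugation) with conj ω = ω⁻¹ and conj s = s.
-- ℂ with ω = e^{2πi/q}, s = √2, conj = complex conjugation is an instance.

record Setting (q : ℕ) (c ℓ : Level) : Set (lsuc (c ⊔ ℓ)) where
  field
    𝕂 : CommutativeRing c ℓ
  open CommutativeRing 𝕂
  open RingOps 𝕂
  field
    ω s        : Carrier
    conj       : Carrier → Carrier
    conj-cong  : ∀ {a b} → a ≈ b → conj a ≈ conj b
    conj-+     : ∀ a b → conj (a + b) ≈ conj a + conj b
    conj-*     : ∀ a b → conj (a * b) ≈ conj a * conj b
    conj-1     : conj 1# ≈ 1#
    conj-invol : ∀ a → conj (conj a) ≈ a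
    conj-ω     : conj ω * ω ≈ 1#
    conj-s     : conj s ≈ s
    ω-q        : pow ω q ≈ 1#
    ω-prim     : ∀ k → 0 < k → k < q → ¬ (pow ω k ≈ 1#)
    s-sq       : s * s ≈ 1# + 1#
    nontriv    : ¬ (1# ≈ 0#)
    domain     : ∀ a b → a * b ≈ 0# → a ≈ 0# ⊎ b ≈ 0#
    char0      : ∀ k → ¬ (fromℕ (suc k) ≈ 0#)

module Bentness {q : ℕ} {c ℓ : Level} (S : Setting q c ℓ) where
  open Setting S
  open CommutativeRing 𝕂
  open RingOps 𝕂

  ωto : Fin q → Carrier
  ωto k = pow ω (toℕ k)

  H : ∀ {n} → (Vec Bool n → Fin q) → Vec Bool n → Carrier
  H {n} f y = sumF2 n (λ x → ωto (f x) * sgn (dot x y))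

  -- |H_f(y)| = 2^{n/2}, i.e. H_f(y) · conj(H_f(y)) = 2ⁿ
  IsBent : ∀ {n} → (Vec Bool n → Fin q) → Set ℓ
  IsBent {n} f = ∀ y → H f y * conj (H f y) ≈ pow (1# + 1#) n

  IsDualOf : ∀ {n} → (Vec Bool n → Fin q) → (Vec Bool n → Fin q) → Set ℓ
  IsDualOf {n} f f̃ = ∀ y → H f y ≈ pow s n * ωto (f̃ y)

IsBent : ∀ {q c ℓ} → Setting q c ℓ → ∀ {n} → (Vec Bool n → Fin q) → Set ℓ
IsBent S = Bentness.IsBent S

IsDualOf : ∀ {q c ℓ} → Setting q c ℓ → ∀ {n} → (Vec Bool n → Fin q) → (Vec Bool n → Fin q) → Set ℓ
IsDualOf S = Bentness.IsDualOf S

IsRegularBentWithDual : ∀ {q c ℓ} → Setting q c ℓ → ∀ {n} → (Vec Bool n → Fin q) → (Vec Bool n → Fin q) → Set ℓ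
IsRegularBentWithDual S f f̃ = IsBent S f Data.Product.× IsDualOf S f f̃
  where import Data.Product

IsSelfDualBent : ∀ {q c ℓ} → Setting q c ℓ → ∀ {n} → (Vec Bool n → Fin q) → Set ℓ
IsSelfDualBent S f = IsRegularBentWithDual S f f

IsAntiSelfDualBent : ∀ {q c ℓ} → Setting q c ℓ → .{{_ : NonZero q}} → ∀ {n} → (Vec Bool n → Fin q) → Set ℓ
IsAntiSelfDualBent {q} S f = IsRegularBentWithDual S f (λ x → shiftHalf q (f x))

-- The Walsh–Hadamard transform on F₂ⁿ squares to 2ⁿ, so the dual of a regular function is
-- regular with dual the original one.  The transform of a function glued from four pieces on
-- F₂ⁿ⁺² is the 2×2 Hadamard transform of the four spectra.  In both constructions the
-- (anti-)self-duality hypotheses make each row of that table a sum or difference of two values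
-- 2^{n/2} ω^{h(a,b,y)}, so the outer butterfly yields 2^{(n+2)/2} ω^{h(a,b,y)}: the glued function
-- is self-dual in both cases, and a regular function is bent because |ω^k| = 1.

module Submission where

open import Defs
open import Level using (Level)
open import Data.Nat using (ℕ; zero; suc; _≤_; NonZero; z≤n; s≤s) renaming (_+_ to _+ℕ_; _*_ to _*ℕ_)
open import Data.Nat.Divisibility using (_∣_)
open import Data.Nat.DivMod using (_/_; _%_; _mod_; m≡m%n+[m/n]*n; m/n*n≡m; m/n<m; /-monoˡ-≤; m%n<n)
import Data.Nat.Properties as ℕ
open import Data.Fin using (Fin; toℕ)
open import Data.Fin.Properties using (toℕ-fromℕ<)
open import Data.Bool using (Bool; true; false; _xor_)
open import Data.Vec using (Vec; []; _∷_)
open import Data.Product using (_×_; _,_)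
open import Data.Sum using (_⊎_; inj₁; inj₂)
open import Data.Empty using (⊥-elim)
open import Relation.Nullary using (¬_)
open import Relation.Binary.PropositionalEquality as ≡ using (_≡_)
open import Algebra.Bundles using (CommutativeRing)
import Algebra.Properties.Ring as RingProperties
import Algebra.Properties.CommutativeSemigroup as CommutativeSemigroupProperties

module WalshHadamard {c ℓ} (R : CommutativeRing c ℓ) where
  open CommutativeRing R
  open RingOps R
  open RingProperties ring using (-1*x≈-x; -‿+-comm; -‿involutive)
  open CommutativeSemigroupProperties +-commutativeSemigroup using (interchange)
  open CommutativeSemigroupProperties *-commutativeSemigroup using (x∙yz≈y∙xz) renaming (interchange to *-interchange)
  open import Relation.Binary.Reasoning.Setoid setoid

  two : Carrier
  two = 1# + 1#

  two*x≈x+x : ∀ x → two * x ≈ x + x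
  two*x≈x+x x = trans (distribʳ x 1# 1#) (+-cong (*-identityˡ x) (*-identityˡ x))

  pow-cong : ∀ m {x y} → x ≈ y → pow x m ≈ pow y m
  pow-cong zero    x≈y = refl
  pow-cong (suc m) x≈y = *-cong x≈y (pow-cong m x≈y)

  pow-+ : ∀ x m k → pow x (m +ℕ k) ≈ pow x m * pow x k
  pow-+ x zero    k = sym (*-identityˡ _)
  pow-+ x (suc m) k = trans (*-congˡ (pow-+ x m k)) (sym (*-assoc _ _ _))

  pow-distrib-* : ∀ x y m → pow (x * y) m ≈ pow x m * pow y m
  pow-distrib-* x y zero    = sym (*-identityˡ 1#)
  pow-distrib-* x y (suc m) = trans (*-congˡ (pow-distrib-* x y m)) (*-interchange x y _ _)

  pow-1# : ∀ m → pow 1# m ≈ 1#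
  pow-1# zero    = refl
  pow-1# (suc m) = trans (*-identityˡ _) (pow-1# m)

  sumF2-cong : ∀ n {F G : Vec Bool n → Carrier} → (∀ x → F x ≈ G x) → sumF2 n F ≈ sumF2 n G
  sumF2-cong zero    F≈G = F≈G []
  sumF2-cong (suc n) F≈G = +-cong (sumF2-cong n (λ x → F≈G (false ∷ x))) (sumF2-cong n (λ x → F≈G (true ∷ x)))

  sumF2-distrib-+ : ∀ n (F G : Vec Bool n → Carrier) →
                    sumF2 n (λ x → F x + G x) ≈ sumF2 n F + sumF2 n G
  sumF2-distrib-+ zero    F G = refl
  sumF2-distrib-+ (suc n) F G =
    trans (+-cong (sumF2-distrib-+ n _ _) (sumF2-distrib-+ n _ _)) (interchange _ _ _ _)

  *-distribˡ-sumF2 : ∀ n k (F : Vec Bool n → Carrier) → k * sumF2 n F ≈ sumF2 n (λ x → k * F x)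
  *-distribˡ-sumF2 zero    k F = refl
  *-distribˡ-sumF2 (suc n) k F =
    trans (distribˡ k _ _) (+-cong (*-distribˡ-sumF2 n k _) (*-distribˡ-sumF2 n k _))

  sgn-xor : ∀ a b → sgn (a xor b) ≈ sgn a * sgn b
  sgn-xor false b     = sym (*-identityˡ _)
  sgn-xor true  false = sym (*-identityʳ _)
  sgn-xor true  true  = sym (trans (-1*x≈-x (- 1#)) (-‿involutive 1#))

  W : ∀ n → (Vec Bool n → Carrier) → Vec Bool n → Carrier
  W n F y = sumF2 n (λ x → F x * sgn (dot x y))

  W-cong : ∀ n {F G : Vec Bool n → Carrier} → (∀ x → F x ≈ G x) → ∀ y → W n F y ≈ W n G y
  W-cong n F≈G y = sumF2-cong n (λ x → *-congʳ (F≈G x))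

  W-distrib-+ : ∀ n (F G : Vec Bool n → Carrier) y → W n (λ x → F x + G x) y ≈ W n F y + W n G y
  W-distrib-+ n F G y = trans (sumF2-cong n (λ x → distribʳ _ (F x) (G x))) (sumF2-distrib-+ n _ _)

  *-distribˡ-W : ∀ n k (F : Vec Bool n → Carrier) y → k * W n F y ≈ W n (λ x → k * F x) y
  *-distribˡ-W n k F y = trans (*-distribˡ-sumF2 n k _) (sumF2-cong n (λ x → sym (*-assoc k (F x) _)))

  W-cons : ∀ n (F : Vec Bool (suc n) → Carrier) a y →
           W (suc n) F (a ∷ y) ≈ W n (λ x → F (false ∷ x)) y + sgn a * W n (λ x → F (true ∷ x)) y
  W-cons n F a y = +-congˡ (begin
    sumF2 n (λ x → F (true ∷ x) * sgn (a xor dot x y))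
      ≈⟨ sumF2-cong n (λ x → *-congˡ (sgn-xor a (dot x y))) ⟩
    sumF2 n (λ x → F (true ∷ x) * (sgn a * sgn (dot x y)))
      ≈⟨ sumF2-cong n (λ x → x∙yz≈y∙xz (F (true ∷ x)) (sgn a) _) ⟩
    sumF2 n (λ x → sgn a * (F (true ∷ x) * sgn (dot x y)))
      ≈⟨ *-distribˡ-sumF2 n (sgn a) _ ⟨
    sgn a * W n (λ x → F (true ∷ x)) y ∎)

  butterfly : ∀ a (φ : Bool → Carrier) → (φ false + φ true) + sgn a * (φ false + - φ true) ≈ two * φ a
  butterfly false φ = begin
    (φ false + φ true) + 1# * (φ false + - φ true) ≈⟨ +-congˡ (*-identityˡ _) ⟩
    (φ false + φ true) + (φ false + - φ true)      ≈⟨ interchange _ _ _ _ ⟩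
    (φ false + φ false) + (φ true + - φ true)      ≈⟨ +-congˡ (-‿inverseʳ _) ⟩
    (φ false + φ false) + 0#                       ≈⟨ +-identityʳ _ ⟩
    φ false + φ false                              ≈⟨ two*x≈x+x _ ⟨
    two * φ false                                  ∎
  butterfly true φ = begin
    (φ false + φ true) + - 1# * (φ false + - φ true) ≈⟨ +-congˡ (-1*x≈-x _) ⟩
    (φ false + φ true) + - (φ false + - φ true)      ≈⟨ +-congˡ (-‿+-comm _ _) ⟨
    (φ false + φ true) + (- φ false + - - φ true)    ≈⟨ +-congˡ (+-congˡ (-‿involutive _)) ⟩
    (φ false + φ true) + (- φ false + φ true)        ≈⟨ interchange _ _ _ _ ⟩
    (φ false + - φ false) + (φ true + φ true)        ≈⟨ +-congʳ (-‿inverseʳ _) ⟩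
    0# + (φ true + φ true)                           ≈⟨ +-identityˡ _ ⟩
    φ true + φ true                                  ≈⟨ two*x≈x+x _ ⟨
    two * φ true                                     ∎

  W-involutive : ∀ n (F : Vec Bool n → Carrier) z → W n (W n F) z ≈ pow two n * F z
  W-involutive zero    F [] = trans (*-identityʳ _) (trans (*-identityʳ _) (sym (*-identityˡ _)))
  W-involutive (suc n) F (a ∷ z) = begin
    W (suc n) (W (suc n) F) (a ∷ z)
      ≈⟨ W-cons n (W (suc n) F) a z ⟩
    W n (λ y → W (suc n) F (false ∷ y)) z + sgn a * W n (λ y → W (suc n) F (true ∷ y)) z
      ≈⟨ +-cong (trans (row false) (+-congˡ (*-identityˡ _))) (*-congˡ (trans (row true) (+-congˡ (-1*x≈-x _)))) ⟩
    (φ false + φ true) + sgn a * (φ false + - φ true)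
      ≈⟨ butterfly a φ ⟩
    two * (pow two n * F (a ∷ z))
      ≈⟨ *-assoc two _ _ ⟨
    pow two (suc n) * F (a ∷ z) ∎
    where
    F₀ F₁ : Vec Bool n → Carrier
    F₀ x = F (false ∷ x)
    F₁ x = F (true ∷ x)
    φ : Bool → Carrier
    φ b = pow two n * F (b ∷ z)
    row : ∀ b → W n (λ y → W (suc n) F (b ∷ y)) z ≈ φ false + sgn b * φ true
    row b = begin
      W n (λ y → W (suc n) F (b ∷ y)) z     ≈⟨ W-cong n (λ y → W-cons n F b y) z ⟩
      W n (λ y → W n F₀ y + sgn b * W n F₁ y) z ≈⟨ W-distrib-+ n _ _ z ⟩
      W n (W n F₀) z + W n (λ y → sgn b * W n F₁ y) z ≈⟨ +-congˡ (*-distribˡ-W n (sgn b) _ z) ⟨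
      W n (W n F₀) z + sgn b * W n (W n F₁) z ≈⟨ +-cong (W-involutive n F₀ z) (*-congˡ (W-involutive n F₁ z)) ⟩
      φ false + sgn b * φ true ∎

module Spectra {q c ℓ} .{{_ : NonZero q}} (S : Setting q c ℓ) where
  open Setting S
  open CommutativeRing 𝕂
  open RingOps 𝕂
  open Bentness S using (ωto; H)
  open WalshHadamard 𝕂
  open RingProperties ring using (-1*x≈-x; -‿involutive; -‿distribʳ-*; +-inverseˡ-unique; x∙y⁻¹≈ε⇒x≈y)
  open CommutativeSemigroupProperties *-commutativeSemigroup using () renaming (interchange to *-interchange)
  open import Algebra.Solver.Ring.NaturalCoefficients.Default commutativeSemiring using (solve; _:+_; _:*_; _:=_)
  open import Relation.Binary.Reasoning.Setoid setoid

  dualSpectrum : ∀ {n} → (Vec Bool n → Fin q) → Vec Bool n → Carrier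
  dualSpectrum {n} g y = pow s n * ωto (g y)

  conj-pow : ∀ x m → conj (pow x m) ≈ pow (conj x) m
  conj-pow x zero    = conj-1
  conj-pow x (suc m) = trans (conj-* x _) (*-congˡ (conj-pow x m))

  ωto-unit : ∀ k → ωto k * conj (ωto k) ≈ 1#
  ωto-unit k = begin
    pow ω m * conj (pow ω m) ≈⟨ *-congˡ (conj-pow ω m) ⟩
    pow ω m * pow (conj ω) m ≈⟨ pow-distrib-* ω (conj ω) m ⟨
    pow (ω * conj ω) m       ≈⟨ pow-cong m (trans (*-comm ω (conj ω)) conj-ω) ⟩
    pow 1# m                 ≈⟨ pow-1# m ⟩
    1#                       ∎
    where m = toℕ k

  pow-s-squared : ∀ m → pow s m * pow s m ≈ pow two m
  pow-s-squared m = trans (sym (pow-distrib-* s s m)) (pow-cong m s-sq)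

  two*[sᵐ*z]≈sᵐ⁺²*z : ∀ m z → two * (pow s m * z) ≈ pow s (suc (suc m)) * z
  two*[sᵐ*z]≈sᵐ⁺²*z m z = begin
    two * (pow s m * z)       ≈⟨ *-assoc two _ z ⟨
    (two * pow s m) * z       ≈⟨ *-congʳ (*-congʳ s-sq) ⟨
    ((s * s) * pow s m) * z   ≈⟨ *-congʳ (*-assoc s s _) ⟩
    (s * (s * pow s m)) * z   ∎

  dual⇒bent : ∀ {n} (f g : Vec Bool n → Fin q) → IsDualOf S f g → IsBent S f
  dual⇒bent {n} f g f-dual y = begin
    H f y * conj (H f y)   ≈⟨ *-cong (f-dual y) (conj-cong (f-dual y)) ⟩
    (P * z) * conj (P * z) ≈⟨ *-congˡ (trans (conj-* P z) (*-congʳ conj-P)) ⟩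
    (P * z) * (P * conj z) ≈⟨ *-interchange P z P (conj z) ⟩
    (P * P) * (z * conj z) ≈⟨ *-cong (pow-s-squared n) (ωto-unit (g y)) ⟩
    pow two n * 1#         ≈⟨ *-identityʳ _ ⟩
    pow two n              ∎
    where
    P z : Carrier
    P = pow s n
    z = ωto (g y)
    conj-P : conj P ≈ P
    conj-P = trans (conj-pow s n) (pow-cong n conj-s)

  s≉0 : ¬ (s ≈ 0#)
  s≉0 s≈0 = char0 1 (begin
    1# + (1# + 0#) ≈⟨ +-congˡ (+-identityʳ 1#) ⟩
    two            ≈⟨ s-sq ⟨
    s * s          ≈⟨ *-congʳ s≈0 ⟩
    0# * s         ≈⟨ zeroˡ s ⟩
    0#             ∎)

  pow-s≉0 : ∀ m → ¬ (pow s m ≈ 0#)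
  pow-s≉0 zero    = nontriv
  pow-s≉0 (suc m) sᵐ⁺¹≈0 with domain s (pow s m) sᵐ⁺¹≈0
  ... | inj₁ s≈0  = s≉0 s≈0
  ... | inj₂ sᵐ≈0 = pow-s≉0 m sᵐ≈0

  *-cancelˡ-≉0 : ∀ a {b c} → ¬ (a ≈ 0#) → a * b ≈ a * c → b ≈ c
  *-cancelˡ-≉0 a {b} {c} a≉0 ab≈ac with domain a (b + - c) (begin
    a * (b + - c)     ≈⟨ distribˡ a b (- c) ⟩
    a * b + a * - c   ≈⟨ +-cong ab≈ac (sym (-‿distribʳ-* a c)) ⟩
    a * c + - (a * c) ≈⟨ -‿inverseʳ _ ⟩
    0#                ∎)
  ... | inj₁ a≈0   = ⊥-elim (a≉0 a≈0)
  ... | inj₂ b-c≈0 = x∙y⁻¹≈ε⇒x≈y b c b-c≈0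

  square≈1⇒±1 : ∀ x → x * x ≈ 1# → x ≈ - 1# ⊎ x ≈ 1#
  square≈1⇒±1 x x²≈1 with domain (x + 1#) (x + - 1#) (begin
    (x + 1#) * (x + - 1#)                 ≈⟨ expand x 1# (- 1#) ⟩
    (x * x + 1# * - 1#) + x * (1# + - 1#) ≈⟨ +-cong (+-cong x²≈1 (*-identityˡ _)) (*-congˡ (-‿inverseʳ 1#)) ⟩
    (1# + - 1#) + x * 0#                  ≈⟨ +-cong (-‿inverseʳ 1#) (zeroʳ x) ⟩
    0# + 0#                               ≈⟨ +-identityʳ 0# ⟩
    0#                                    ∎)
    where
    expand : ∀ x o m → (x + o) * (x + m) ≈ (x * x + o * m) + x * (o + m)
    expand = solve 3 (λ x o m → (x :+ o) :* (x :+ m) := (x :* x :+ o :* m) :+ x :* (o :+ m)) refl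
  ... | inj₁ x+1≈0 = inj₁ (+-inverseˡ-unique x 1# x+1≈0)
  ... | inj₂ x-1≈0 = inj₂ (x∙y⁻¹≈ε⇒x≈y x 1# x-1≈0)

  dual-involutive : ∀ {n} (f g : Vec Bool n → Fin q) → IsDualOf S f g → IsDualOf S g f
  dual-involutive {n} f g f-dual z = *-cancelˡ-≉0 (pow s n) (pow-s≉0 n) (begin
    pow s n * H g z                   ≈⟨ *-distribˡ-W n (pow s n) (λ y → ωto (g y)) z ⟩
    W n (dualSpectrum g) z            ≈⟨ W-cong n (λ y → sym (f-dual y)) z ⟩
    W n (H f) z                       ≈⟨ W-involutive n (λ x → ωto (f x)) z ⟩
    pow two n * ωto (f z)             ≈⟨ *-congʳ (pow-s-squared n) ⟨
    (pow s n * pow s n) * ωto (f z)   ≈⟨ *-assoc _ _ _ ⟩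
    pow s n * dualSpectrum f z        ∎)

  ω^kq≈1 : ∀ k → pow ω (k *ℕ q) ≈ 1#
  ω^kq≈1 zero    = refl
  ω^kq≈1 (suc k) = trans (pow-+ ω q (k *ℕ q)) (trans (*-cong ω-q (ω^kq≈1 k)) (*-identityˡ 1#))

  ωto-mod : ∀ m → ωto (m mod q) ≈ pow ω m
  ωto-mod m = begin
    pow ω (toℕ (m mod q))               ≡⟨ ≡.cong (pow ω) (toℕ-fromℕ< (m%n<n m q)) ⟩
    pow ω (m % q)                       ≈⟨ *-identityʳ _ ⟨
    pow ω (m % q) * 1#                  ≈⟨ *-congˡ (ω^kq≈1 (m / q)) ⟨
    pow ω (m % q) * pow ω (m / q *ℕ q)  ≈⟨ pow-+ ω (m % q) _ ⟨
    pow ω (m % q +ℕ m / q *ℕ q)         ≡⟨ ≡.cong (pow ω) (≡.sym (m≡m%n+[m/n]*n m q)) ⟩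
    pow ω m                             ∎

  H-glue4 : ∀ {n} (A B C D : Vec Bool n → Fin q) a b y →
            H (glue4 A B C D) (a ∷ b ∷ y) ≈ (H A y + sgn b * H B y) + sgn a * (H C y + sgn b * H D y)
  H-glue4 {n} A B C D a b y =
    trans (W-cons (suc n) (λ x → ωto (h x)) a (b ∷ y))
          (+-cong (W-cons n (λ x → ωto (h (false ∷ x))) b y) (*-congˡ (W-cons n (λ x → ωto (h (true ∷ x))) b y)))
    where
    h : Vec Bool (suc (suc n)) → Fin q
    h = glue4 A B C D

  cornerSpectrum : ∀ {n} → (Vec Bool (suc (suc n)) → Fin q) → Bool → Vec Bool n → Bool → Carrier
  cornerSpectrum h b y a = dualSpectrum (λ x → h (a ∷ b ∷ x)) y

  HadamardRows : ∀ {n} (A B C D : Vec Bool n → Fin q) → Set ℓ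
  HadamardRows A B C D = ∀ b y → let φ = cornerSpectrum (glue4 A B C D) b y in
    (H A y + sgn b * H B y ≈ φ false + φ true) × (H C y + sgn b * H D y ≈ φ false + - φ true)

  glue4-isSelfDual : ∀ {n} (A B C D : Vec Bool n → Fin q) → HadamardRows A B C D →
                     IsDualOf S (glue4 A B C D) (glue4 A B C D)
  glue4-isSelfDual {n} A B C D rows (a ∷ b ∷ y) with rows b y
  ... | row₀ , row₁ = begin
    H (glue4 A B C D) (a ∷ b ∷ y)                             ≈⟨ H-glue4 A B C D a b y ⟩
    (H A y + sgn b * H B y) + sgn a * (H C y + sgn b * H D y) ≈⟨ +-cong row₀ (*-congˡ row₁) ⟩
    (φ false + φ true) + sgn a * (φ false + - φ true)         ≈⟨ butterfly a φ ⟩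
    two * φ a                                                 ≈⟨ two*[sᵐ*z]≈sᵐ⁺²*z n _ ⟩
    pow s (suc (suc n)) * ωto (glue4 A B C D (a ∷ b ∷ y))    ∎
    where
    φ : Bool → Carrier
    φ = cornerSpectrum (glue4 A B C D) b y

  module _ (2≤q : 2 ≤ q) (2∣q : 2 ∣ q) where

    ω^[q/2]≈-1 : pow ω (q / 2) ≈ - 1#
    ω^[q/2]≈-1 with square≈1⇒±1 (pow ω (q / 2)) square≈1
      where
      q/2+q/2≡q : q / 2 +ℕ q / 2 ≡ q
      q/2+q/2≡q = ≡.trans (≡.cong (q / 2 +ℕ_) (≡.sym (ℕ.+-identityʳ _)))
                          (≡.trans (ℕ.*-comm 2 (q / 2)) (m/n*n≡m 2∣q))
      square≈1 : pow ω (q / 2) * pow ω (q / 2) ≈ 1#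
      square≈1 = begin
        pow ω (q / 2) * pow ω (q / 2) ≈⟨ pow-+ ω (q / 2) (q / 2) ⟨
        pow ω (q / 2 +ℕ q / 2)        ≡⟨ ≡.cong (pow ω) q/2+q/2≡q ⟩
        pow ω q                       ≈⟨ ω-q ⟩
        1#                            ∎
    ... | inj₁ ≈-1 = ≈-1
    ... | inj₂ ≈1  = ⊥-elim (ω-prim (q / 2) (/-monoˡ-≤ 2 2≤q) (m/n<m q 2 (s≤s (s≤s z≤n))) ≈1)

    ωto-shiftHalf : ∀ k → ωto (shiftHalf q k) ≈ - ωto k
    ωto-shiftHalf k = begin
      ωto ((toℕ k +ℕ q / 2) mod q) ≈⟨ ωto-mod _ ⟩
      pow ω (toℕ k +ℕ q / 2)       ≈⟨ pow-+ ω (toℕ k) (q / 2) ⟩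
      ωto k * pow ω (q / 2)        ≈⟨ *-congˡ ω^[q/2]≈-1 ⟩
      ωto k * - 1#                 ≈⟨ *-comm _ _ ⟩
      - 1# * ωto k                 ≈⟨ -1*x≈-x _ ⟩
      - ωto k                      ∎

    dualSpectrum-shiftHalf : ∀ {n} (g : Vec Bool n → Fin q) y →
                             dualSpectrum (λ x → shiftHalf q (g x)) y ≈ - dualSpectrum g y
    dualSpectrum-shiftHalf g y = trans (*-congˡ (ωto-shiftHalf (g y))) (sym (-‿distribʳ-* _ _))

    H-shiftHalf : ∀ {n} (f : Vec Bool n → Fin q) y → H (λ x → shiftHalf q (f x)) y ≈ - H f y
    H-shiftHalf {n} f y = begin
      H (λ x → shiftHalf q (f x)) y  ≈⟨ W-cong n (λ x → trans (ωto-shiftHalf (f x)) (sym (-1*x≈-x _))) y ⟩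
      W n (λ x → - 1# * ωto (f x)) y ≈⟨ *-distribˡ-W n (- 1#) _ y ⟨
      - 1# * H f y                   ≈⟨ -1*x≈-x _ ⟩
      - H f y                        ∎

    glue4-regular-isSelfDual : ∀ {n} (f f̃ : Vec Bool n → Fin q) → IsDualOf S f f̃ →
      IsDualOf S (glue4 f f̃ f̃ (λ x → shiftHalf q (f x))) (glue4 f f̃ f̃ (λ x → shiftHalf q (f x)))
    glue4-regular-isSelfDual {n} f f̃ f-dual = glue4-isSelfDual f f̃ f̃ f⁺ rows
      where
      f⁺ : Vec Bool n → Fin q
      f⁺ x = shiftHalf q (f x)
      f̃-dual : IsDualOf S f̃ f
      f̃-dual = dual-involutive f f̃ f-dual
      f⁺-spectrum : ∀ y → H f⁺ y ≈ - dualSpectrum f̃ y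
      f⁺-spectrum y = trans (H-shiftHalf f y) (-‿cong (f-dual y))
      rows : HadamardRows f f̃ f̃ f⁺
      rows false y =
        trans (+-cong (f-dual y) (trans (*-identityˡ _) (f̃-dual y))) (+-comm _ _) ,
        +-cong (f̃-dual y) (trans (*-identityˡ _) (f⁺-spectrum y))
      rows true y =
        +-cong (f-dual y) (trans (-1*x≈-x _) (trans (-‿cong (f̃-dual y)) (sym (dualSpectrum-shiftHalf f y)))) ,
        (begin
          H f̃ y + - 1# * H f⁺ y                      ≈⟨ +-cong (f̃-dual y) (trans (-1*x≈-x _) (-‿cong (f⁺-spectrum y))) ⟩
          dualSpectrum f y + - - dualSpectrum f̃ y    ≈⟨ trans (+-congˡ (-‿involutive _)) (+-comm _ _) ⟩
          dualSpectrum f̃ y + dualSpectrum f y        ≈⟨ +-congˡ (trans (-‿cong (dualSpectrum-shiftHalf f y)) (-‿involutive _)) ⟨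
          dualSpectrum f̃ y + - dualSpectrum f⁺ y     ∎)

    glue4-selfDual-antiSelfDual-isSelfDual : ∀ {n} (f g : Vec Bool n → Fin q) →
      IsDualOf S f f → IsDualOf S g (λ x → shiftHalf q (g x)) →
      IsDualOf S (glue4 f g (λ x → shiftHalf q (g x)) f) (glue4 f g (λ x → shiftHalf q (g x)) f)
    glue4-selfDual-antiSelfDual-isSelfDual {n} f g f-selfDual g-antiSelfDual = glue4-isSelfDual f g g⁺ f rows
      where
      g⁺ : Vec Bool n → Fin q
      g⁺ x = shiftHalf q (g x)
      -dualSpectrum-g⁺ : ∀ y → - dualSpectrum g⁺ y ≈ dualSpectrum g y
      -dualSpectrum-g⁺ y = trans (-‿cong (dualSpectrum-shiftHalf g y)) (-‿involutive _)
      -H-g : ∀ y → - H g y ≈ dualSpectrum g y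
      -H-g y = trans (-‿cong (g-antiSelfDual y)) (-dualSpectrum-g⁺ y)
      g⁺-spectrum : ∀ y → H g⁺ y ≈ dualSpectrum g y
      g⁺-spectrum y = trans (H-shiftHalf g y) (-H-g y)
      rows : HadamardRows f g g⁺ f
      rows false y =
        +-cong (f-selfDual y) (trans (*-identityˡ _) (g-antiSelfDual y)) ,
        trans (+-cong (g⁺-spectrum y) (trans (*-identityˡ _) (f-selfDual y)))
              (trans (+-comm _ _) (+-congˡ (sym (-dualSpectrum-g⁺ y))))
      rows true y =
        trans (+-cong (f-selfDual y) (trans (-1*x≈-x _) (-H-g y))) (+-comm _ _) ,
        +-cong (g⁺-spectrum y) (trans (-1*x≈-x _) (-‿cong (f-selfDual y)))

proposition3 : ∀ {c ℓ : Level} (q : ℕ) .{{_ : NonZero q}} → 2 ≤ q → 2 ∣ q →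
    (S : Setting q c ℓ) → (n : ℕ) → 1 ≤ n →
    ((f f̃ : Vec Bool n → Fin q) → IsRegularBentWithDual S f f̃ →
      IsSelfDualBent S (glue4 f f̃ f̃ (λ x → shiftHalf q (f x))))
    ×
    ((f g : Vec Bool n → Fin q) → IsSelfDualBent S f → IsAntiSelfDualBent S g →
      IsBent S (glue4 f g (λ x → shiftHalf q (g x)) f))
proposition3 q 2≤q 2∣q S n _ =
    (λ f f̃ (_ , f-dual) → let h = glue4 f f̃ f̃ (λ x → shiftHalf q (f x))
                               h-selfDual = glue4-regular-isSelfDual 2≤q 2∣q f f̃ f-dual
                           in dual⇒bent h h h-selfDual , h-selfDual)
  , (λ f g (_ , f-selfDual) (_ , g-antiSelfDual) → let h = glue4 f g (λ x → shiftHalf q (g x)) f in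
       dual⇒bent h h (glue4-selfDual-antiSelfDual-isSelfDual 2≤q 2∣q f g f-selfDual g-antiSelfDual))
  where open Spectra S
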